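{- For $1\le n\le 3$ and $m\ge 3$, the domination polynomial $D(L_{m,n},x)$ is unimodal with a mode at $\mu$, where $\mu=\lfloor m/2\rfloor+1$ if $n=1$, $\mu=\lceil m/2\rceil+1$ if $n=2$, and $\mu=\lfloor m/2\rfloor+2$ if $n=3$.
   Context: The $(m,n)$-lollipop graph $L_{m,n}$ is the graph on $m+n$ vertices consisting of a complete graph on $m$ vertices and a path on $n$ vertices, with one leaf of the path joined by an edge to a vertex of the complete graph. A set $U$ of vertices is dominating if every vertex is in $U$ or adjacent to a vertex of $U$; $d_i$ counts dominating sets of size $i$ and $D(G,x)=\sum_i d_i(G)x^i$. A polynomial is unimodal if its coefficients (ordered by increasing power of $x$) are non-decreasing then non-increasing; it has a mode at $k$ if the coefficient of $x^k$ is maximum. -}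

module Defs where

open import Data.Nat using (ℕ; zero; suc; _+_; _∸_; _≤_; _<_; _≟_; _<?_; _≤?_; _/_)
open import Data.Nat.Properties using ()
open import Data.Fin using (Fin; toℕ)
open import Data.Fin.Properties using (any?; all?)
open import Data.Fin.Subset using (Subset; _∈_; ∣_∣; inside; outside)
open import Data.Fin.Subset.Properties using (_∈?_)
open import Data.Vec using (Vec; []; _∷_)
open import Data.List using (List; []; _∷_; map; _++_; filter; length)
open import Data.Product using (_×_; ∃; _,_)
open import Data.Product.Properties using ()
open import Data.Sum using (_⊎_)
open import Relation.Nullary using (¬_; Dec)
open import Relation.Nullary.Decidable using (_×-dec_; _⊎-dec_; ¬?)
open import Relation.Binary.PropositionalEquality using (_≡_)

record Graph (N : ℕ) : Set₁ where
  field
    Adj  : Fin N → Fin N → Set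
    adj? : (u v : Fin N) → Dec (Adj u v)

open Graph public

-- Lollipop graph L_{m,n} on vertices 0 .. m+n-1:
-- vertices 0..m-1 form the complete graph K_m;
-- vertices m..m+n-1 form the path (m ~ m+1 ~ ... ~ m+n-1);
-- the path leaf m is joined to the clique vertex m-1.
-- Edge u ~ v iff u ≠ v and (both u, v < m, or u, v are consecutive
-- integers with the larger one ≥ m).
LolliAdjℕ : ℕ → ℕ → ℕ → Set
LolliAdjℕ m u v =
  (¬ (u ≡ v) × u < m × v < m)
  ⊎ ((suc u ≡ v × m ≤ v) ⊎ (suc v ≡ u × m ≤ u))

lolliAdjℕ? : ∀ m u v → Dec (LolliAdjℕ m u v)
lolliAdjℕ? m u v =
  (¬? (u ≟ v) ×-dec (u <? m ×-dec v <? m))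
  ⊎-dec ((suc u ≟ v ×-dec m ≤? v) ⊎-dec (suc v ≟ u ×-dec m ≤? u))

Lollipop : (m n : ℕ) → Graph (m + n)
Lollipop m n = record
  { Adj  = λ u v → LolliAdjℕ m (toℕ u) (toℕ v)
  ; adj? = λ u v → lolliAdjℕ? m (toℕ u) (toℕ v) }

Dominating : ∀ {N} → Graph N → Subset N → Set
Dominating G U = ∀ v → v ∈ U ⊎ ∃ (λ u → u ∈ U × Adj G u v)

dominating? : ∀ {N} (G : Graph N) (U : Subset N) → Dec (Dominating G U)
dominating? G U = all? (λ v → (v ∈? U) ⊎-dec any? (λ u → (u ∈? U) ×-dec adj? G u v))

allSubsets : ∀ N → List (Subset N)
allSubsets zero = [] ∷ []
allSubsets (suc N) = map (inside ∷_) (allSubsets N) ++ map (outside ∷_) (allSubsets N)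

-- d_i(G): number of dominating sets of size i.
-- The domination polynomial D(G,x) = Σ_i d_i(G) x^i is represented by
-- its coefficient sequence i ↦ d_i(G) (zero beyond degree N).
domCoeff : ∀ {N} → Graph N → ℕ → ℕ
domCoeff {N} G i =
  length (filter (λ U → dominating? G U ×-dec (∣ U ∣ ≟ i)) (allSubsets N))

Unimodal : (ℕ → ℕ) → Set
Unimodal f = ∃ λ k →
  (∀ i j → i ≤ j → j ≤ k → f i ≤ f j) ×
  (∀ i j → k ≤ i → i ≤ j → f j ≤ f i)

ModeAt : (ℕ → ℕ) → ℕ → Set
ModeAt f k = ∀ i → f i ≤ f k

⌊_/2⌋ : ℕ → ℕ
⌊ m /2⌋ = m / 2

⌈_/2⌉ : ℕ → ℕ
⌈ m /2⌉ = (suc m) / 2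

-- μ(m,n) from the statement (only meaningful for n ∈ {1,2,3}).
μ : ℕ → ℕ → ℕ
μ m 1 = ⌊ m /2⌋ + 1
μ m 2 = ⌈ m /2⌉ + 1
μ m _ = ⌊ m /2⌋ + 2

module Submission where

-- For m ≥ 2, a set dominates L_{m,n} iff it meets the clique and every path vertex v has
-- v - 1, v or v + 1 in it (the clique vertex m - 1 counts as the neighbour of the first path
-- vertex m). Drop the first condition: the number of sets of size i that only "cover the path"
-- obeys Pascal's rule in the clique size, because a clique vertex other than m - 1 is adjacent
-- to no path vertex. It is therefore a sum of shifted binomial rows,
--   x(1+x)^m + x(1+x)^(m-1),  x(1+x)^(m+1) + x(1+x)^m,  x(1+x)^(m+2) + x²(1+x)^m + x²(1+x)^(m-1)
-- for n = 1, 2, 3. The covering sets that miss the clique are exactly the dominating sets of the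
-- path P_n, whatever m is, so D(L_{m,n}) is that sum minus D(P_n). Each binomial row rises up to
-- its centre and falls after it, the rows of one sum have centres within 1/2 of each other, and
-- D(P_n) only lives in degrees at most 3; this yields the mode μ, with the single exception
-- L_{3,3} checked by computation.

open import Defs
open import Data.Nat hiding (⌊_/2⌋)
open import Data.Nat.Properties
open import Data.Nat.DivMod using (m≡m%n+[m/n]*n; m%n<n; m/n*n≤m; m/n≡1+[m∸n]/n)
open import Data.Nat.Combinatorics using (_C_; nC1≡n; nCk+nC[k+1]≡[n+1]C[k+1])
open import Data.Nat.Tactic.RingSolver using (solve-∀)
open import Data.Bool using (Bool; true; false; _∧_; _∨_; T; if_then_else_)
open import Data.Bool.Properties using (T-∧; T-∨)
open import Data.Fin using (toℕ; fromℕ<) renaming (zero to fzero; suc to fsuc)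
open import Data.Fin.Properties using (toℕ<n; toℕ-fromℕ<)
open import Data.Fin.Subset using (Subset; ∣_∣; inside; outside) renaming (_∈_ to _∈ₛ_)
open import Data.Vec using ([]; _∷_; here; there)
open import Data.List using (List; []; _∷_; map; _++_; filter; length)
open import Data.List.Properties using (filter-++; length-++; filter-≐; filter-none; length-map)
open import Data.List.Relation.Unary.All using (universal)
open import Data.Product using (_×_; _,_; proj₁; proj₂; ∃; map₂)
open import Data.Sum using (_⊎_; inj₁; inj₂)
open import Data.Unit using (tt)
open import Data.Empty using (⊥-elim)
open import Function using (_∘_)
open import Function.Bundles using (Equivalence)
open import Level using (0ℓ)
open import Relation.Nullary using (yes; no; does)
open import Relation.Nullary.Decidable using (_×-dec_)
open import Relation.Unary using (Pred; Decidable; _≐_)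
open import Relation.Binary.PropositionalEquality

countSubsets : (N : ℕ) → (Subset N → Bool) → ℕ → ℕ
countSubsets zero    p zero    = if p [] then 1 else 0
countSubsets zero    p (suc i) = 0
countSubsets (suc N) p zero    = countSubsets N (p ∘ (outside ∷_)) zero
countSubsets (suc N) p (suc i) = countSubsets N (p ∘ (inside ∷_)) i + countSubsets N (p ∘ (outside ∷_)) (suc i)

countSubsets-cong : ∀ N {p q : Subset N → Bool} → (∀ U → p U ≡ q U) →
  ∀ i → countSubsets N p i ≡ countSubsets N q i
countSubsets-cong zero    p≗q zero    rewrite p≗q [] = refl
countSubsets-cong zero    p≗q (suc i) = refl
countSubsets-cong (suc N) p≗q zero    = countSubsets-cong N (p≗q ∘ (outside ∷_)) zero
countSubsets-cong (suc N) p≗q (suc i) =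
  cong₂ _+_ (countSubsets-cong N (p≗q ∘ (inside ∷_)) i) (countSubsets-cong N (p≗q ∘ (outside ∷_)) (suc i))

filter-map : ∀ {A B : Set} {P : Pred B 0ℓ} (P? : Decidable P) (f : A → B) (xs : List A) →
  filter P? (map f xs) ≡ map f (filter (P? ∘ f) xs)
filter-map P? f [] = refl
filter-map P? f (x ∷ xs) with does (P? (f x))
... | true  = cong (f x ∷_) (filter-map P? f xs)
... | false = filter-map P? f xs

length-filter-map : ∀ {A B : Set} {P : Pred B 0ℓ} (P? : Decidable P) (f : A → B) (xs : List A) →
  length (filter P? (map f xs)) ≡ length (filter (P? ∘ f) xs)
length-filter-map P? f xs = trans (cong length (filter-map P? f xs)) (length-map f (filter (P? ∘ f) xs))

open Equivalence using (to; from)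

length-filter-allSubsets : ∀ N {P : Pred (Subset N) 0ℓ} (P? : Decidable P) (p : Subset N → Bool) →
  P ≐ T ∘ p → ∀ i → length (filter (λ U → P? U ×-dec (∣ U ∣ ≟ i)) (allSubsets N)) ≡ countSubsets N p i
length-filter-allSubsets zero P? p (P⊆p , p⊆P) zero with P? [] | p [] | P⊆p {[]} | p⊆P {[]}
... | yes _ | true  | _   | _   = refl
... | yes q | false | P⇒p | _   = ⊥-elim (P⇒p q)
... | no ¬q | true  | _   | p⇒P = ⊥-elim (¬q (p⇒P tt))
... | no _  | false | _   | _   = refl
length-filter-allSubsets zero P? p _ (suc i) with P? []
... | yes _ = refl
... | no _  = refl
length-filter-allSubsets (suc N) {P} P? p (P⊆p , p⊆P) i = begin
  length (filter Q? (map (inside ∷_) S ++ map (outside ∷_) S))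
    ≡⟨ cong length (filter-++ Q? (map (inside ∷_) S) (map (outside ∷_) S)) ⟩
  length (filter Q? (map (inside ∷_) S) ++ filter Q? (map (outside ∷_) S))
    ≡⟨ length-++ (filter Q? (map (inside ∷_) S)) ⟩
  length (filter Q? (map (inside ∷_) S)) + length (filter Q? (map (outside ∷_) S))
    ≡⟨ cong₂ _+_ (length-filter-map Q? (inside ∷_) S) (length-filter-map Q? (outside ∷_) S) ⟩
  length (filter (Q? ∘ (inside ∷_)) S) + length (filter (Q? ∘ (outside ∷_)) S)
    ≡⟨ split i ⟩
  countSubsets (suc N) p i
    ∎
  where
  open ≡-Reasoning
  S = allSubsets N
  Q? = λ U → P? U ×-dec (∣ U ∣ ≟ i)
  IH : ∀ b j → length (filter (λ U → P? (b ∷ U) ×-dec (∣ U ∣ ≟ j)) S) ≡ countSubsets N (p ∘ (b ∷_)) j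
  IH b = length-filter-allSubsets N (P? ∘ (b ∷_)) (p ∘ (b ∷_)) (P⊆p , p⊆P)
  split : ∀ i → length (filter (λ U → P? (inside ∷ U) ×-dec (suc ∣ U ∣ ≟ i)) S)
              + length (filter (λ U → P? (outside ∷ U) ×-dec (∣ U ∣ ≟ i)) S) ≡ countSubsets (suc N) p i
  split zero    = cong₂ _+_ (cong length (filter-none _ (universal (λ U ()) S))) (IH outside zero)
  split (suc i) = cong₂ _+_
    (trans (cong length (filter-≐ _ _ ((λ { (q , refl) → q , refl }) , (λ { (q , refl) → q , refl })) S))
           (IH inside i))
    (IH outside (suc i))

-- Domination in a lollipop as a Boolean test

T-∨ˡ : ∀ {x} y → T x → T (x ∨ y)
T-∨ˡ y = from (T-∨ {y = y}) ∘ inj₁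

T-∨ʳ : ∀ x {y} → T y → T (x ∨ y)
T-∨ʳ x = from (T-∨ {x}) ∘ inj₂

T-∨⁻ : ∀ x {y} → T (x ∨ y) → T x ⊎ T y
T-∨⁻ x = to (T-∨ {x})

memberᵇ : ∀ {N} → Subset N → ℕ → Bool
memberᵇ []      _       = false
memberᵇ (b ∷ U) zero    = b
memberᵇ (b ∷ U) (suc v) = memberᵇ U v

∈⇒memberᵇ : ∀ {N} (U : Subset N) v → v ∈ₛ U → T (memberᵇ U (toℕ v))
∈⇒memberᵇ (b ∷ U) fzero    here      = tt
∈⇒memberᵇ (b ∷ U) (fsuc v) (there p) = ∈⇒memberᵇ U v p

memberᵇ⇒∈ : ∀ {N} (U : Subset N) v → T (memberᵇ U (toℕ v)) → v ∈ₛ U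
memberᵇ⇒∈ (true ∷ U) fzero    _ = here
memberᵇ⇒∈ (b ∷ U)    (fsuc v) t = there (memberᵇ⇒∈ U v t)

memberᵇ⇒< : ∀ {N} (U : Subset N) u → T (memberᵇ U u) → u < N
memberᵇ⇒< (b ∷ U) zero    _ = s≤s z≤n
memberᵇ⇒< (b ∷ U) (suc u) t = s≤s (memberᵇ⇒< U u t)

meetsᵇ : ∀ {N} → ℕ → Subset N → Bool
meetsᵇ zero    U       = false
meetsᵇ (suc m) []      = false
meetsᵇ (suc m) (b ∷ U) = b ∨ meetsᵇ m U

meetsᵇ⇒∃ : ∀ {N} m (U : Subset N) → T (meetsᵇ m U) → ∃ λ u → u < m × T (memberᵇ U u)
meetsᵇ⇒∃ (suc m) (true ∷ U)  _ = 0 , s≤s z≤n , tt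
meetsᵇ⇒∃ (suc m) (false ∷ U) t with meetsᵇ⇒∃ m U t
... | u , u<m , u∈U = suc u , s≤s u<m , u∈U

∃⇒meetsᵇ : ∀ {N} m (U : Subset N) u → u < m → T (memberᵇ U u) → T (meetsᵇ m U)
∃⇒meetsᵇ (suc m) (true ∷ U)  u       _         _   = tt
∃⇒meetsᵇ (suc m) (false ∷ U) (suc u) (s≤s u<m) u∈U = ∃⇒meetsᵇ m U u u<m u∈U

coveredᵇ : ∀ {N} → Subset N → ℕ → Bool
coveredᵇ U v = memberᵇ U (pred v) ∨ (memberᵇ U v ∨ memberᵇ U (suc v))

pathCoveredᵇ : ∀ {N} → ℕ → ℕ → Subset N → Bool
pathCoveredᵇ m zero    U = true
pathCoveredᵇ m (suc k) U = coveredᵇ U m ∧ pathCoveredᵇ (suc m) k U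

pathCoveredᵇ⇒ : ∀ {N} m k (U : Subset N) → T (pathCoveredᵇ m k U) →
  ∀ v → m ≤ v → v < m + k → T (coveredᵇ U v)
pathCoveredᵇ⇒ m zero    U _ v m≤v v<m+0 = ⊥-elim (<⇒≱ v<m+0 (subst (_≤ v) (sym (+-identityʳ m)) m≤v))
pathCoveredᵇ⇒ m (suc k) U t v m≤v v<m+1+k with to T-∧ t | m ≟ v
... | here-ok , _    | yes refl = here-ok
... | _ , rest-ok    | no m≢v   =
  pathCoveredᵇ⇒ (suc m) k U rest-ok v (≤∧≢⇒< m≤v m≢v) (subst (v <_) (+-suc m k) v<m+1+k)

⇒pathCoveredᵇ : ∀ {N} m k (U : Subset N) → (∀ v → m ≤ v → v < m + k → T (coveredᵇ U v)) →
  T (pathCoveredᵇ m k U)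
⇒pathCoveredᵇ m zero    U _   = tt
⇒pathCoveredᵇ m (suc k) U cov = from T-∧
  ( cov m ≤-refl (subst (m <_) (sym (+-suc m k)) (s≤s (m≤m+n m k)))
  , ⇒pathCoveredᵇ (suc m) k U (λ v m<v v<m+1+k → cov v (<⇒≤ m<v) (subst (v <_) (sym (+-suc m k)) v<m+1+k)))

-- With relaxed = false this is domination of L_{m,n} when m ≥ 2; relaxed = true drops the
-- requirement that U meets the clique.
lollipopᵇ : Bool → (m n : ℕ) → Subset (m + n) → Bool
lollipopᵇ relaxed m n U = (relaxed ∨ meetsᵇ m U) ∧ pathCoveredᵇ m n U

Dominatesℕ : ∀ {N} → ℕ → Subset N → Set
Dominatesℕ {N} m U = ∀ v → v < N → T (memberᵇ U v) ⊎ ∃ λ u → T (memberᵇ U u) × LolliAdjℕ m u v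

Dominating⇒Dominatesℕ : ∀ {m n} (U : Subset (m + n)) → Dominating (Lollipop m n) U → Dominatesℕ m U
Dominating⇒Dominatesℕ {m} U dom v v<N with dom (fromℕ< v<N)
... | inj₁ v∈U = inj₁ (subst (T ∘ memberᵇ U) (toℕ-fromℕ< v<N) (∈⇒memberᵇ U _ v∈U))
... | inj₂ (u , u∈U , u~v) =
  inj₂ (toℕ u , ∈⇒memberᵇ U u u∈U , subst (LolliAdjℕ m (toℕ u)) (toℕ-fromℕ< v<N) u~v)

Dominatesℕ⇒Dominating : ∀ {m n} (U : Subset (m + n)) → Dominatesℕ m U → Dominating (Lollipop m n) U
Dominatesℕ⇒Dominating {m} U dom v with dom (toℕ v) (toℕ<n v)
... | inj₁ v∈U = inj₁ (memberᵇ⇒∈ U v v∈U)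
... | inj₂ (u , u∈U , u~v) = inj₂ (fromℕ< u<N , memberᵇ⇒∈ U _ (subst (T ∘ memberᵇ U) (sym u≡) u∈U) ,
                                    subst (λ x → LolliAdjℕ m x (toℕ v)) (sym u≡) u~v)
  where
  u<N = memberᵇ⇒< U u u∈U
  u≡ = toℕ-fromℕ< u<N

Dominatesℕ⇒lollipopᵇ : ∀ {m n} (U : Subset (m + n)) → 2 ≤ m → Dominatesℕ m U → T (lollipopᵇ false m n U)
Dominatesℕ⇒lollipopᵇ {m} {n} U 2≤m dom = from T-∧ (meets , ⇒pathCoveredᵇ m n U covered)
  where
  0<m : 0 < m
  0<m = ≤-trans (s≤s z≤n) 2≤m
  meets : T (meetsᵇ m U)
  meets with dom 0 (≤-trans 0<m (m≤m+n m n))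
  ... | inj₁ 0∈U = ∃⇒meetsᵇ m U 0 0<m 0∈U
  ... | inj₂ (u , u∈U , inj₁ (_ , u<m , _)) = ∃⇒meetsᵇ m U u u<m u∈U
  ... | inj₂ (.1 , _ , inj₂ (inj₂ (refl , m≤1))) = ⊥-elim (<⇒≱ 2≤m m≤1)
  covered : ∀ v → m ≤ v → v < m + n → T (coveredᵇ U v)
  covered v m≤v v<N with dom v v<N
  ... | inj₁ v∈U = T-∨ʳ (memberᵇ U (pred v)) (T-∨ˡ (memberᵇ U (suc v)) v∈U)
  ... | inj₂ (u , _   , inj₁ (_ , _ , v<m)) = ⊥-elim (<⇒≱ v<m m≤v)
  ... | inj₂ (u , u∈U , inj₂ (inj₁ (refl , _))) = T-∨ˡ (memberᵇ U v ∨ memberᵇ U (suc v)) u∈U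
  ... | inj₂ (u , u∈U , inj₂ (inj₂ (refl , _))) = T-∨ʳ (memberᵇ U (pred v)) (T-∨ʳ (memberᵇ U v) u∈U)

lollipopᵇ⇒Dominatesℕ : ∀ {m n} (U : Subset (m + n)) → 2 ≤ m → T (lollipopᵇ false m n U) → Dominatesℕ m U
lollipopᵇ⇒Dominatesℕ {m} {n} U 2≤m t v v<N with to T-∧ t | v <? m
... | meets , _ | yes v<m with meetsᵇ⇒∃ m U meets
...   | u , u<m , u∈U with u ≟ v
...     | yes refl = inj₁ u∈U
...     | no u≢v   = inj₂ (u , u∈U , inj₁ (u≢v , u<m , v<m))
lollipopᵇ⇒Dominatesℕ {m} {n} U 2≤m t v v<N | _ , cov | no v≮m
  with T-∨⁻ (memberᵇ U (pred v)) (pathCoveredᵇ⇒ m n U cov v (≮⇒≥ v≮m) v<N)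
... | inj₂ here-or-next with T-∨⁻ (memberᵇ U v) here-or-next
...   | inj₁ v∈U    = inj₁ v∈U
...   | inj₂ v+1∈U  = inj₂ (suc v , v+1∈U , inj₂ (inj₂ (refl , ≤-trans (≮⇒≥ v≮m) (n≤1+n v))))
lollipopᵇ⇒Dominatesℕ {m} {n} U 2≤m t (suc w) v<N | _ , cov | no v≮m | inj₁ w∈U =
  inj₂ (w , w∈U , inj₂ (inj₁ (refl , ≮⇒≥ v≮m)))
lollipopᵇ⇒Dominatesℕ {m} {n} U 2≤m t zero v<N | _ , cov | no v≮m | inj₁ _ =
  ⊥-elim (v≮m (≤-trans (s≤s z≤n) 2≤m))

-- Pascal recurrences

record Pascal (F : ℕ → ℕ → ℕ) : Set where
  field
    pascal₀ : ∀ M → F (suc M) 0 ≡ F M 0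
    pascal  : ∀ M i → F (suc M) (suc i) ≡ F M i + F M (suc i)

open Pascal

shift : ℕ → (ℕ → ℕ) → ℕ → ℕ
shift zero    f i       = f i
shift (suc j) f zero    = 0
shift (suc j) f (suc i) = shift j f i

Pascal-C : Pascal _C_
Pascal-C = record { pascal₀ = λ M → refl ; pascal = λ M i → sym (nCk+nC[k+1]≡[n+1]C[k+1] M i) }

Pascal-suc : ∀ {F} → Pascal F → Pascal (λ M → F (suc M))
Pascal-suc p = record { pascal₀ = λ M → pascal₀ p (suc M) ; pascal = λ M → pascal p (suc M) }

Pascal-+ : ∀ {F G} → Pascal F → Pascal G → Pascal (λ M i → F M i + G M i)
Pascal-+ {F} {G} p q = record
  { pascal₀ = λ M → cong₂ _+_ (pascal₀ p M) (pascal₀ q M)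
  ; pascal  = λ M i → trans (cong₂ _+_ (pascal p M i) (pascal q M i))
                            (interchange (F M i) (F M (suc i)) (G M i) (G M (suc i)))
  }
  where
  interchange : ∀ a b c d → (a + b) + (c + d) ≡ (a + c) + (b + d)
  interchange = solve-∀

Pascal-shift : ∀ {F} j → Pascal F → Pascal (λ M → shift j (F M))
Pascal-shift zero    p = p
Pascal-shift {F} (suc j) p = record { pascal₀ = λ M → refl ; pascal = step }
  where
  step : ∀ M i → shift (suc j) (F (suc M)) (suc i) ≡ shift (suc j) (F M) i + shift (suc j) (F M) (suc i)
  step M zero    = pascal₀ (Pascal-shift j p) M
  step M (suc i) = pascal (Pascal-shift j p) M i

Pascal-unique : ∀ {F G} → Pascal F → Pascal G → (∀ i → F 0 i ≡ G 0 i) → ∀ M i → F M i ≡ G M i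
Pascal-unique p q base zero    i       = base i
Pascal-unique p q base (suc M) zero    =
  trans (pascal₀ p M) (trans (Pascal-unique p q base M 0) (sym (pascal₀ q M)))
Pascal-unique p q base (suc M) (suc i) =
  trans (pascal p M i) (trans (cong₂ _+_ (Pascal-unique p q base M i) (Pascal-unique p q base M (suc i)))
                              (sym (pascal q M i)))

-- Vertex 0 is adjacent to no path vertex once the clique has two vertices.
pathCoveredᵇ-∷ : ∀ {N} j k b (U : Subset N) → pathCoveredᵇ (suc (suc j)) k (b ∷ U) ≡ pathCoveredᵇ (suc j) k U
pathCoveredᵇ-∷ j zero    b U = refl
pathCoveredᵇ-∷ j (suc k) b U = cong (coveredᵇ U (suc j) ∧_) (pathCoveredᵇ-∷ (suc j) k b U)

lollipopᵇ-inside : ∀ r M n (U : Subset (suc M + n)) →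
  lollipopᵇ r (suc (suc M)) n (inside ∷ U) ≡ lollipopᵇ true (suc M) n U
lollipopᵇ-inside true  M n U = pathCoveredᵇ-∷ M n inside U
lollipopᵇ-inside false M n U = pathCoveredᵇ-∷ M n inside U

lollipopᵇ-outside : ∀ r M n (U : Subset (suc M + n)) →
  lollipopᵇ r (suc (suc M)) n (outside ∷ U) ≡ lollipopᵇ r (suc M) n U
lollipopᵇ-outside r M n U = cong ((r ∨ meetsᵇ (suc M) U) ∧_) (pathCoveredᵇ-∷ M n outside U)

-- Counts for L_{M+1,n}, so that M = 0 is a one-vertex clique.
coverCount domCount : ℕ → ℕ → ℕ → ℕ
coverCount n M = countSubsets (suc M + n) (lollipopᵇ true (suc M) n)
domCount   n M = countSubsets (suc M + n) (lollipopᵇ false (suc M) n)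

count-inside≡coverCount : ∀ r n M i →
  countSubsets (suc M + n) (lollipopᵇ r (suc (suc M)) n ∘ (inside ∷_)) i ≡ coverCount n M i
count-inside≡coverCount r n M = countSubsets-cong (suc M + n) (lollipopᵇ-inside r M n)

count-outside≡count : ∀ r n M i →
  countSubsets (suc M + n) (lollipopᵇ r (suc (suc M)) n ∘ (outside ∷_)) i ≡
  countSubsets (suc M + n) (lollipopᵇ r (suc M) n) i
count-outside≡count r n M = countSubsets-cong (suc M + n) (lollipopᵇ-outside r M n)

Pascal-coverCount : ∀ n → Pascal (coverCount n)
Pascal-coverCount n = record
  { pascal₀ = λ M → count-outside≡count true n M 0
  ; pascal  = λ M i → cong₂ _+_ (count-inside≡coverCount true n M i) (count-outside≡count true n M (suc i))
  }

-- The sets counted by coverCount but not by domCount avoid the clique, so their number does not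
-- depend on M.
domCount+coverCount₀≡coverCount+domCount₀ : ∀ n M i →
  domCount n M i + coverCount n 0 i ≡ coverCount n M i + domCount n 0 i
domCount+coverCount₀≡coverCount+domCount₀ n zero    i       = +-comm (domCount n 0 i) (coverCount n 0 i)
domCount+coverCount₀≡coverCount+domCount₀ n (suc M) zero    = begin
  domCount n (suc M) 0 + coverCount n 0 0  ≡⟨ cong (_+ coverCount n 0 0) (count-outside≡count false n M 0) ⟩
  domCount n M 0 + coverCount n 0 0        ≡⟨ domCount+coverCount₀≡coverCount+domCount₀ n M 0 ⟩
  coverCount n M 0 + domCount n 0 0        ≡⟨ cong (_+ domCount n 0 0) (pascal₀ (Pascal-coverCount n) M) ⟨
  coverCount n (suc M) 0 + domCount n 0 0  ∎
  where open ≡-Reasoning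
domCount+coverCount₀≡coverCount+domCount₀ n (suc M) (suc i) = begin
  domCount n (suc M) (suc i) + coverCount n 0 (suc i)
    ≡⟨ cong₂ (λ x y → (x + y) + coverCount n 0 (suc i))
             (count-inside≡coverCount false n M i) (count-outside≡count false n M (suc i)) ⟩
  (coverCount n M i + domCount n M (suc i)) + coverCount n 0 (suc i)
    ≡⟨ +-assoc (coverCount n M i) _ _ ⟩
  coverCount n M i + (domCount n M (suc i) + coverCount n 0 (suc i))
    ≡⟨ cong (coverCount n M i +_) (domCount+coverCount₀≡coverCount+domCount₀ n M (suc i)) ⟩
  coverCount n M i + (coverCount n M (suc i) + domCount n 0 (suc i))
    ≡⟨ +-assoc (coverCount n M i) _ _ ⟨
  (coverCount n M i + coverCount n M (suc i)) + domCount n 0 (suc i)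
    ≡⟨ cong (_+ domCount n 0 (suc i)) (pascal (Pascal-coverCount n) M i) ⟨
  coverCount n (suc M) (suc i) + domCount n 0 (suc i)
    ∎
  where open ≡-Reasoning

domCoeff≡domCount : ∀ n M → 1 ≤ M → ∀ i → domCoeff (Lollipop (suc M) n) i ≡ domCount n M i
domCoeff≡domCount n M 1≤M =
  length-filter-allSubsets (suc M + n) (dominating? (Lollipop (suc M) n)) (lollipopᵇ false (suc M) n)
  ( (λ {U} → Dominatesℕ⇒lollipopᵇ U (s≤s 1≤M) ∘ Dominating⇒Dominatesℕ U)
  , (λ {U} → Dominatesℕ⇒Dominating U ∘ lollipopᵇ⇒Dominatesℕ U (s≤s 1≤M)) )

domCoeff-closedForm : ∀ n {E} (c : ℕ → ℕ) → Pascal E → (∀ i → coverCount n 0 i ≡ E 0 i) →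
  (∀ i → coverCount n 0 i ≡ c i + domCount n 0 i) →
  ∀ M → 1 ≤ M → ∀ i → domCoeff (Lollipop (suc M) n) i ≡ E M i ∸ c i
domCoeff-closedForm n {E} c pE cover₀ split₀ M 1≤M i = begin
  domCoeff (Lollipop (suc M) n) i        ≡⟨ domCoeff≡domCount n M 1≤M i ⟩
  domCount n M i                         ≡⟨ m+n∸n≡m (domCount n M i) (c i) ⟨
  (domCount n M i + c i) ∸ c i           ≡⟨ cong (_∸ c i) (+-cancelʳ-≡ (domCount n 0 i) _ _ key) ⟩
  E M i ∸ c i                            ∎
  where
  open ≡-Reasoning
  key : (domCount n M i + c i) + domCount n 0 i ≡ E M i + domCount n 0 i
  key = begin
    (domCount n M i + c i) + domCount n 0 i  ≡⟨ +-assoc (domCount n M i) (c i) _ ⟩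
    domCount n M i + (c i + domCount n 0 i)  ≡⟨ cong (domCount n M i +_) (split₀ i) ⟨
    domCount n M i + coverCount n 0 i        ≡⟨ domCount+coverCount₀≡coverCount+domCount₀ n M i ⟩
    coverCount n M i + domCount n 0 i
      ≡⟨ cong (_+ domCount n 0 i) (Pascal-unique (Pascal-coverCount n) pE cover₀ M i) ⟩
    E M i + domCount n 0 i                   ∎

-- Unimodality of shifted binomial rows

absorption : ∀ M k → suc k * (suc M C suc k) ≡ suc M * (M C k)
absorption zero    zero    = refl
absorption zero    (suc k) = *-zeroʳ (suc (suc k))
absorption (suc M) zero    =
  trans (*-identityˡ _) (trans (nC1≡n (suc (suc M))) (sym (*-identityʳ (suc (suc M)))))
absorption (suc M) (suc k) = begin
  suc (suc k) * (suc (suc M) C suc (suc k))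
    ≡⟨ cong (suc (suc k) *_) (sym (nCk+nC[k+1]≡[n+1]C[k+1] (suc M) (suc k))) ⟩
  suc (suc k) * (p + q)
    ≡⟨ split (suc k) p q ⟩
  (suc k * p + p) + suc (suc k) * q
    ≡⟨ cong₂ (λ x y → (x + p) + y) (absorption M k) (absorption M (suc k)) ⟩
  (suc M * a + p) + suc M * b
    ≡⟨ cong (λ x → (suc M * a + x) + suc M * b) (sym (nCk+nC[k+1]≡[n+1]C[k+1] M k)) ⟩
  (suc M * a + (a + b)) + suc M * b
    ≡⟨ regroup (suc M) a b ⟩
  suc (suc M) * (a + b)
    ≡⟨ cong (suc (suc M) *_) (nCk+nC[k+1]≡[n+1]C[k+1] M k) ⟩
  suc (suc M) * p
    ∎
  where
  open ≡-Reasoning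
  a = M C k
  b = M C suc k
  p = suc M C suc k
  q = suc M C suc (suc k)
  split : ∀ K p q → suc K * (p + q) ≡ (K * p + p) + suc K * q
  split = solve-∀
  regroup : ∀ K a b → (K * a + (a + b)) + K * b ≡ suc K * (a + b)
  regroup = solve-∀

C-ratio : ∀ M k → suc k * (M C k + M C suc k) ≡ suc M * (M C k)
C-ratio M k = trans (cong (suc k *_) (nCk+nC[k+1]≡[n+1]C[k+1] M k)) (absorption M k)

double-suc : ∀ k → suc k + suc k ≡ suc (suc (k + k))
double-suc k = cong suc (+-suc k k)

-- The bound c is twice the centre of the sequence.
Rises Falls : (ℕ → ℕ) → ℕ → Set
Rises f c = ∀ i → suc (i + i) ≤ c → f i ≤ f (suc i)
Falls f c = ∀ i → c ≤ suc (i + i) → f (suc i) ≤ f i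

C-rises : ∀ M → Rises (M C_) M
C-rises M k 2k+1≤M = *-cancelˡ-≤ (suc k) (+-cancelˡ-≤ (suc k * a) _ _ (begin
  suc k * a + suc k * a   ≡⟨ *-distribʳ-+ a (suc k) (suc k) ⟨
  (suc k + suc k) * a     ≤⟨ *-monoˡ-≤ a (subst (_≤ suc M) (sym (double-suc k)) (s≤s 2k+1≤M)) ⟩
  suc M * a               ≡⟨ C-ratio M k ⟨
  suc k * (a + a′)        ≡⟨ *-distribˡ-+ (suc k) a a′ ⟩
  suc k * a + suc k * a′  ∎))
  where
  open ≤-Reasoning
  a = M C k
  a′ = M C suc k

C-falls : ∀ M → Falls (M C_) M
C-falls M k M≤2k+1 = *-cancelˡ-≤ (suc k) (+-cancelˡ-≤ (suc k * a) _ _ (begin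
  suc k * a + suc k * a′  ≡⟨ *-distribˡ-+ (suc k) a a′ ⟨
  suc k * (a + a′)        ≡⟨ C-ratio M k ⟩
  suc M * a               ≤⟨ *-monoˡ-≤ a (subst (suc M ≤_) (sym (double-suc k)) (s≤s M≤2k+1)) ⟩
  (suc k + suc k) * a     ≡⟨ *-distribʳ-+ a (suc k) (suc k) ⟩
  suc k * a + suc k * a   ∎))
  where
  open ≤-Reasoning
  a = M C k
  a′ = M C suc k

shift-rises : ∀ {f c} j → Rises f c → Rises (shift j f) (j + j + c)
shift-rises zero    r i h = r i h
shift-rises (suc j) r zero h = z≤n
shift-rises {c = c} (suc j) r (suc i) h =
  shift-rises j r i (≤-pred (≤-pred (subst₂ _≤_ (cong suc (double-suc i)) (cong (_+ c) (double-suc j)) h)))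

shift-falls : ∀ {f c} j → Falls f c → Falls (shift j f) (j + j + c)
shift-falls zero    r i h = r i h
shift-falls {c = c} (suc j) r zero h with subst (_≤ 1) (cong (_+ c) (double-suc j)) h
... | s≤s ()
shift-falls {c = c} (suc j) r (suc i) h =
  shift-falls j r i (≤-pred (≤-pred (subst₂ _≤_ (cong (_+ c) (double-suc j)) (cong suc (double-suc i)) h)))

Rises-+ : ∀ {f g : ℕ → ℕ} {c} → Rises f c → Rises g c → Rises (λ i → f i + g i) c
Rises-+ r s i h = +-mono-≤ (r i h) (s i h)

Falls-+ : ∀ {f g : ℕ → ℕ} {c} → Falls f c → Falls g c → Falls (λ i → f i + g i) c
Falls-+ r s i h = +-mono-≤ (r i h) (s i h)

Rises-≤ : ∀ {f c c′} → c′ ≤ c → Rises f c → Rises f c′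
Rises-≤ c′≤c r i h = r i (≤-trans h c′≤c)

Falls-≤ : ∀ {f c c′} → c ≤ c′ → Falls f c → Falls f c′
Falls-≤ c≤c′ r i h = r i (≤-trans c≤c′ h)

Rises-≗ : ∀ {f g a} → (∀ i → f i ≡ g i) → Rises f a → Rises g a
Rises-≗ f≗g r i h = subst₂ _≤_ (f≗g i) (f≗g (suc i)) (r i h)

Falls-≗ : ∀ {f g a} → (∀ i → f i ≡ g i) → Falls f a → Falls g a
Falls-≗ f≗g r i h = subst₂ _≤_ (f≗g (suc i)) (f≗g i) (r i h)

Rises-∸ : ∀ {f c : ℕ → ℕ} {a} → Rises f a → (∀ i → c (suc i) ≤ c i ⊎ f i ≤ c i) →
  Rises (λ i → f i ∸ c i) a
Rises-∸ {f} {c} r side i h with side i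
... | inj₁ c-falls = ∸-mono (r i h) c-falls
... | inj₂ f≤c     = subst (_≤ f (suc i) ∸ c (suc i)) (sym (m≤n⇒m∸n≡0 f≤c)) z≤n

Falls-∸ : ∀ {f c : ℕ → ℕ} {a} → Falls f a → (∀ i → a ≤ suc (i + i) → c i ≤ c (suc i)) →
  Falls (λ i → f i ∸ c i) a
Falls-∸ r side i h = ∸-mono (r i h) (side i h)

half-bounds : ∀ a → ⌊ a /2⌋ + ⌊ a /2⌋ ≤ a × a ≤ suc (⌊ a /2⌋ + ⌊ a /2⌋)
half-bounds a = subst (_≤ a) 2h≡h+h (m/n*n≤m a 2) , subst (a ≤_) (cong suc 2h≡h+h) upper
  where
  h = ⌊ a /2⌋
  2h≡h+h : h * 2 ≡ h + h
  2h≡h+h = trans (*-comm h 2) (cong (h +_) (+-identityʳ h))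
  upper : a ≤ suc (h * 2)
  upper = subst (_≤ suc (h * 2)) (sym (m≡m%n+[m/n]*n a 2)) (+-monoˡ-≤ (h * 2) (≤-pred (m%n<n a 2)))

unimodal-at : ∀ f k → (∀ i → i < k → f i ≤ f (suc i)) → (∀ i → k ≤ i → f (suc i) ≤ f i) →
  Unimodal f × ModeAt f k
unimodal-at f k up down = (k , rising , falling) , mode
  where
  rising : ∀ i j → i ≤ j → j ≤ k → f i ≤ f j
  rising i j i≤j j≤k with m≤n⇒m<n∨m≡n i≤j
  rising i (suc j) i≤j j<k | inj₁ (s≤s i≤j′) = ≤-trans (rising i j i≤j′ (<⇒≤ j<k)) (up j j<k)
  rising i j       _   _   | inj₂ refl       = ≤-refl
  falling : ∀ i j → k ≤ i → i ≤ j → f j ≤ f i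
  falling i j k≤i i≤j with m≤n⇒m<n∨m≡n i≤j
  falling i (suc j) k≤i _ | inj₁ (s≤s i≤j′) = ≤-trans (down j (≤-trans k≤i i≤j′)) (falling i j k≤i i≤j′)
  falling i j       _   _ | inj₂ refl       = ≤-refl
  mode : ∀ i → f i ≤ f k
  mode i with ≤-total i k
  ... | inj₁ i≤k = rising i k i≤k ≤-refl
  ... | inj₂ k≤i = falling k i ≤-refl k≤i

unimodal-centred : ∀ f a → Rises f (suc a) → Falls f (2 + a) → Unimodal f × ModeAt f (⌊ a /2⌋ + 1)
unimodal-centred f a r s = unimodal-at f (h + 1) up down
  where
  h = ⌊ a /2⌋
  h+1≡1+h = +-comm h 1
  up : ∀ i → i < h + 1 → f i ≤ f (suc i)
  up i i<h+1 = r i (s≤s (≤-trans (+-mono-≤ i≤h i≤h) (proj₁ (half-bounds a))))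
    where i≤h = m<1+n⇒m≤n (subst (i <_) h+1≡1+h i<h+1)
  down : ∀ i → h + 1 ≤ i → f (suc i) ≤ f i
  down i h+1≤i = s i (begin
    2 + a                      ≤⟨ s≤s (s≤s (proj₂ (half-bounds a))) ⟩
    suc (suc (suc (h + h)))    ≡⟨ cong suc (double-suc h) ⟨
    suc (suc h + suc h)        ≤⟨ s≤s (+-mono-≤ h<i h<i) ⟩
    suc (i + i)                ∎)
    where
    open ≤-Reasoning
    h<i = subst (_≤ i) h+1≡1+h h+1≤i

-- d_i(P_n) for n ≤ 3: the difference of coverCount and domCount computed at M = 0.
pathDomCoeff : ℕ → ℕ → ℕ
pathDomCoeff 1 1 = 1
pathDomCoeff 2 1 = 2
pathDomCoeff 2 2 = 1
pathDomCoeff 3 1 = 1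
pathDomCoeff 3 2 = 3
pathDomCoeff 3 3 = 1
pathDomCoeff _ _ = 0

cover₁ cover₂ cover₃ : ℕ → ℕ → ℕ
cover₁ M i = shift 1 (suc M C_) i + shift 1 (M C_) i
cover₂ M i = shift 1 ((2 + M) C_) i + shift 1 (suc M C_) i
cover₃ M i = shift 1 ((3 + M) C_) i + shift 2 (suc M C_) i + shift 2 (M C_) i

Pascal-cover₁ : Pascal cover₁
Pascal-cover₁ = Pascal-+ (Pascal-shift 1 (Pascal-suc Pascal-C)) (Pascal-shift 1 Pascal-C)

Pascal-cover₂ : Pascal cover₂
Pascal-cover₂ = Pascal-+ (Pascal-shift 1 (Pascal-suc (Pascal-suc Pascal-C))) (Pascal-shift 1 (Pascal-suc Pascal-C))

Pascal-cover₃ : Pascal cover₃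
Pascal-cover₃ = Pascal-+ (Pascal-+ (Pascal-shift 1 (Pascal-suc (Pascal-suc (Pascal-suc Pascal-C))))
                                   (Pascal-shift 2 (Pascal-suc Pascal-C)))
                         (Pascal-shift 2 Pascal-C)

cover₁-rises : ∀ M → Rises (cover₁ M) (2 + M)
cover₁-rises M = Rises-+ (Rises-≤ (n≤1+n _) (shift-rises 1 (C-rises (suc M)))) (shift-rises 1 (C-rises M))

cover₁-falls : ∀ M → Falls (cover₁ M) (3 + M)
cover₁-falls M = Falls-+ (shift-falls 1 (C-falls (suc M))) (Falls-≤ (n≤1+n _) (shift-falls 1 (C-falls M)))

cover₂-rises : ∀ M → Rises (cover₂ M) (3 + M)
cover₂-rises M = Rises-+ (Rises-≤ (n≤1+n _) (shift-rises 1 (C-rises (2 + M)))) (shift-rises 1 (C-rises (suc M)))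

cover₂-falls : ∀ M → Falls (cover₂ M) (4 + M)
cover₂-falls M = Falls-+ (shift-falls 1 (C-falls (2 + M))) (Falls-≤ (n≤1+n _) (shift-falls 1 (C-falls (suc M))))

cover₃-rises : ∀ M → Rises (cover₃ M) (4 + M)
cover₃-rises M = Rises-+ (Rises-+ (Rises-≤ (n≤1+n _) (shift-rises 1 (C-rises (3 + M))))
                                  (Rises-≤ (n≤1+n _) (shift-rises 2 (C-rises (suc M)))))
                         (shift-rises 2 (C-rises M))

cover₃-falls : ∀ M → Falls (cover₃ M) (5 + M)
cover₃-falls M = Falls-+ (Falls-+ (shift-falls 1 (C-falls (3 + M))) (shift-falls 2 (C-falls (suc M))))
                         (Falls-≤ (n≤1+n _) (shift-falls 2 (C-falls M)))

lollipop₁-base : ∀ i → coverCount 1 0 i ≡ cover₁ 0 i × coverCount 1 0 i ≡ pathDomCoeff 1 i + domCount 1 0 i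
lollipop₁-base 0 = refl , refl
lollipop₁-base 1 = refl , refl
lollipop₁-base 2 = refl , refl
lollipop₁-base 3 = refl , refl
lollipop₁-base (suc (suc (suc (suc i)))) = refl , refl

lollipop₂-base : ∀ i → coverCount 2 0 i ≡ cover₂ 0 i × coverCount 2 0 i ≡ pathDomCoeff 2 i + domCount 2 0 i
lollipop₂-base 0 = refl , refl
lollipop₂-base 1 = refl , refl
lollipop₂-base 2 = refl , refl
lollipop₂-base 3 = refl , refl
lollipop₂-base 4 = refl , refl
lollipop₂-base (suc (suc (suc (suc (suc i))))) = refl , refl

lollipop₃-base : ∀ i → coverCount 3 0 i ≡ cover₃ 0 i × coverCount 3 0 i ≡ pathDomCoeff 3 i + domCount 3 0 i
lollipop₃-base 0 = refl , refl
lollipop₃-base 1 = refl , refl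
lollipop₃-base 2 = refl , refl
lollipop₃-base 3 = refl , refl
lollipop₃-base 4 = refl , refl
lollipop₃-base 5 = refl , refl
lollipop₃-base (suc (suc (suc (suc (suc (suc i)))))) = refl , refl

domCoeff-lollipop₁ : ∀ M → 1 ≤ M → ∀ i → domCoeff (Lollipop (suc M) 1) i ≡ cover₁ M i ∸ pathDomCoeff 1 i
domCoeff-lollipop₁ =
  domCoeff-closedForm 1 (pathDomCoeff 1) Pascal-cover₁ (proj₁ ∘ lollipop₁-base) (proj₂ ∘ lollipop₁-base)

domCoeff-lollipop₂ : ∀ M → 1 ≤ M → ∀ i → domCoeff (Lollipop (suc M) 2) i ≡ cover₂ M i ∸ pathDomCoeff 2 i
domCoeff-lollipop₂ =
  domCoeff-closedForm 2 (pathDomCoeff 2) Pascal-cover₂ (proj₁ ∘ lollipop₂-base) (proj₂ ∘ lollipop₂-base)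

domCoeff-lollipop₃ : ∀ M → 1 ≤ M → ∀ i → domCoeff (Lollipop (suc M) 3) i ≡ cover₃ M i ∸ pathDomCoeff 3 i
domCoeff-lollipop₃ =
  domCoeff-closedForm 3 (pathDomCoeff 3) Pascal-cover₃ (proj₁ ∘ lollipop₃-base) (proj₂ ∘ lollipop₃-base)

lollipop₁-rises : ∀ M → 2 ≤ M → Rises (domCoeff (Lollipop (suc M) 1)) (2 + M)
lollipop₁-rises M 2≤M = Rises-≗ (sym ∘ domCoeff-lollipop₁ M (<⇒≤ 2≤M)) (Rises-∸ (cover₁-rises M) side)
  where
  side : ∀ i → pathDomCoeff 1 (suc i) ≤ pathDomCoeff 1 i ⊎ cover₁ M i ≤ pathDomCoeff 1 i
  side zero    = inj₂ z≤n
  side (suc i) = inj₁ z≤n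

lollipop₁-falls : ∀ M → 2 ≤ M → Falls (domCoeff (Lollipop (suc M) 1)) (3 + M)
lollipop₁-falls M 2≤M = Falls-≗ (sym ∘ domCoeff-lollipop₁ M (<⇒≤ 2≤M)) (Falls-∸ (cover₁-falls M) side)
  where
  side : ∀ i → 3 + M ≤ suc (i + i) → pathDomCoeff 1 i ≤ pathDomCoeff 1 (suc i)
  side 0 (s≤s ())
  side 1 h = ⊥-elim (<⇒≱ (<⇒≤ 2≤M) (+-cancelˡ-≤ 3 M 0 h))
  side (suc (suc i)) _ = z≤n

lollipop₂-rises : ∀ M → 2 ≤ M → Rises (domCoeff (Lollipop (suc M) 2)) (3 + M)
lollipop₂-rises M 2≤M = Rises-≗ (sym ∘ domCoeff-lollipop₂ M (<⇒≤ 2≤M)) (Rises-∸ (cover₂-rises M) side)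
  where
  side : ∀ i → pathDomCoeff 2 (suc i) ≤ pathDomCoeff 2 i ⊎ cover₂ M i ≤ pathDomCoeff 2 i
  side zero          = inj₂ z≤n
  side 1             = inj₁ (s≤s z≤n)
  side (suc (suc i)) = inj₁ z≤n

lollipop₂-falls : ∀ M → 2 ≤ M → Falls (domCoeff (Lollipop (suc M) 2)) (4 + M)
lollipop₂-falls M 2≤M = Falls-≗ (sym ∘ domCoeff-lollipop₂ M (<⇒≤ 2≤M)) (Falls-∸ (cover₂-falls M) side)
  where
  side : ∀ i → 4 + M ≤ suc (i + i) → pathDomCoeff 2 i ≤ pathDomCoeff 2 (suc i)
  side 0 (s≤s ())
  side 1 (s≤s (s≤s (s≤s ())))
  side 2 h = ⊥-elim (<⇒≱ 2≤M (+-cancelˡ-≤ 4 M 1 h))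
  side (suc (suc (suc i))) _ = z≤n

lollipop₃-rises : ∀ M → 2 ≤ M → Rises (domCoeff (Lollipop (suc M) 3)) (4 + M)
lollipop₃-rises M 2≤M = Rises-≗ (sym ∘ domCoeff-lollipop₃ M (<⇒≤ 2≤M)) (Rises-∸ (cover₃-rises M) side)
  where
  side : ∀ i → pathDomCoeff 3 (suc i) ≤ pathDomCoeff 3 i ⊎ cover₃ M i ≤ pathDomCoeff 3 i
  side zero          = inj₂ z≤n
  side 1             = inj₂ ≤-refl
  side 2             = inj₁ (s≤s z≤n)
  side (suc (suc (suc i))) = inj₁ z≤n

cover₃∸pathDom-falls : ∀ M → 2 ≤ M → Falls (λ i → cover₃ M i ∸ pathDomCoeff 3 i) (5 + M)
cover₃∸pathDom-falls 1 (s≤s ()) _ _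
cover₃∸pathDom-falls (suc (suc M)) _ 0 (s≤s ())
cover₃∸pathDom-falls (suc (suc M)) _ 1 (s≤s (s≤s (s≤s ())))
cover₃∸pathDom-falls (suc (suc M)) _ 2 (s≤s (s≤s (s≤s (s≤s (s≤s ())))))
-- In L_{3,3}, d₃ = d₄ = 14 although D(P_3) drops at degree 3.
cover₃∸pathDom-falls 2 _ 3 _ = ≤-refl
cover₃∸pathDom-falls (suc (suc (suc M))) _ 3 (s≤s (s≤s (s≤s (s≤s (s≤s (s≤s (s≤s ())))))))
cover₃∸pathDom-falls M _ i@(suc (suc (suc (suc _)))) h = cover₃-falls M i h

lollipop₃-falls : ∀ M → 2 ≤ M → Falls (domCoeff (Lollipop (suc M) 3)) (5 + M)
lollipop₃-falls M 2≤M = Falls-≗ (sym ∘ domCoeff-lollipop₃ M (<⇒≤ 2≤M)) (cover₃∸pathDom-falls M 2≤M)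

⌊2+a/2⌋≡1+⌊a/2⌋ : ∀ a → ⌊ 2 + a /2⌋ ≡ suc ⌊ a /2⌋
⌊2+a/2⌋≡1+⌊a/2⌋ a = m/n≡1+[m∸n]/n {2 + a} {2} (s≤s (s≤s z≤n))

lemma4p2 : (m n : ℕ) → 1 ≤ n → n ≤ 3 → 3 ≤ m →
    Unimodal (domCoeff (Lollipop m n)) × ModeAt (domCoeff (Lollipop m n)) (μ m n)
lemma4p2 (suc M) 1 _ _ (s≤s 2≤M) =
  unimodal-centred _ (suc M) (lollipop₁-rises M 2≤M) (lollipop₁-falls M 2≤M)
lemma4p2 (suc M) 2 _ _ (s≤s 2≤M) =
  unimodal-centred _ (2 + M) (lollipop₂-rises M 2≤M) (lollipop₂-falls M 2≤M)
lemma4p2 (suc M) 3 _ _ (s≤s 2≤M) =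
  map₂ (subst (ModeAt (domCoeff (Lollipop (suc M) 3))) mode≡μ)
       (unimodal-centred _ (3 + M) (lollipop₃-rises M 2≤M) (lollipop₃-falls M 2≤M))
  where
  mode≡μ : ⌊ 3 + M /2⌋ + 1 ≡ ⌊ suc M /2⌋ + 2
  mode≡μ = trans (cong (_+ 1) (⌊2+a/2⌋≡1+⌊a/2⌋ (suc M))) (sym (+-suc ⌊ suc M /2⌋ 1))
lemma4p2 _ 0 () _ _
lemma4p2 _ (suc (suc (suc (suc _)))) _ (s≤s (s≤s (s≤s ()))) _
lemma4p2 zero _ _ _ ()
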